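{- Let $S$ be a subset of the finite abelian group $G$ such that $\Gamma_G(S)$ is Hamiltonian. Then $|S|\ge \operatorname{rk}(G)$; moreover, if $G$ is of type $(m_1,\ldots,m_{\operatorname{rk}(G)})$ with $m_1>2$, then $|S|\ge \operatorname{rk}(G)+1$.
   Context: For a subset $S$ of a finite abelian group $G$, the addition Cayley graph $\Gamma_G(S)$ has vertex set $G$ and edge set $\{(g',g'')\in G\times G : g'+g''\in S\}$. $\Gamma_G(S)$ is Hamiltonian if there is a listing $(g_1,\ldots,g_n)$ of all $n=|G|$ elements of $G$ with $g_i+g_{i+1}\in S$ for all $i$ (indices mod $n$); in particular, when $|G|=2$ and $S$ contains the non-zero element, $\Gamma_G(S)$ counts as Hamiltonian. $\operatorname{rk}(G)$ is the rank of $G$. "$G$ is of type $(m_1,\ldots,m_r)$" means $G\cong \mathbb Z/m_1\mathbb Z\oplus\cdots\oplus\mathbb Z/m_r\mathbb Z$ with $1<m_1\mid m_2\mid\cdots\mid m_r$, $r=\operatorname{rk}(G)$. -}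

module Defs where

open import Data.Nat using (ℕ; zero; suc; _+_; _<_)
open import Data.Nat.DivMod using (_mod_)
open import Data.Nat.Divisibility using (_∣_)
open import Data.Fin using (Fin; toℕ)
open import Data.List using (List; []; _∷_; length)
open import Data.List.Relation.Unary.All using (All)
open import Data.List.Relation.Unary.Linked using (Linked)
open import Data.List.Relation.Unary.Unique.Propositional using (Unique)
open import Data.List.Membership.Propositional using (_∈_)
open import Data.Product using (Σ; _×_; _,_)
open import Data.Unit using (⊤; tt)
open import Function.Definitions using (Bijective)
open import Relation.Binary.PropositionalEquality using (_≡_)

_+ₘ_ : {m : ℕ} → Fin m → Fin m → Fin m
_+ₘ_ {suc k} a b = (toℕ a + toℕ b) mod suc k

-- The group ℤ/m₁ ⊕ ⋯ ⊕ ℤ/m_r for the list ms = (m₁, …, m_r).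
Grp : List ℕ → Set
Grp []       = ⊤
Grp (m ∷ ms) = Fin m × Grp ms

_⊕_ : {ms : List ℕ} → Grp ms → Grp ms → Grp ms
_⊕_ {[]}     _        _        = tt
_⊕_ {m ∷ ms} (a , x) (b , y) = (a +ₘ b) , (x ⊕ y)

IsType : List ℕ → Set
IsType ms = All (1 <_) ms × Linked _∣_ ms

record Subset (ms : List ℕ) : Set where
  constructor subset
  field
    elems  : List (Grp ms)
    unique : Unique elems

∣_∣ : {ms : List ℕ} → Subset ms → ℕ
∣ S ∣ = length (Subset.elems S)

_∈S_ : {ms : List ℕ} → Grp ms → Subset ms → Set
g ∈S S = g ∈ Subset.elems S

nextIdx : {n : ℕ} → Fin (suc n) → Fin (suc n)
nextIdx {n} i = (suc (toℕ i)) mod suc n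

-- The addition Cayley graph Γ_G(S) is Hamiltonian: there is a listing
-- (g₁,…,g_N) of all elements of G (a bijection Fin N → G, hence N = |G|)
-- with gᵢ + gᵢ₊₁ ∈ S for all i, indices taken mod N.
Hamiltonian : (ms : List ℕ) → Subset ms → Set
Hamiltonian ms S =
  Σ ℕ λ n → Σ (Fin (suc n) → Grp ms) λ g →
    Bijective _≡_ _≡_ g × ((i : Fin (suc n)) → (g i ⊕ g (nextIdx i)) ∈S S)

-- Reduce every coordinate modulo m = m₁, which divides all mᵢ: this maps G onto (ℤ/m)ʳ.
-- Write S = {s₀, …, s_k}. Consecutive vertices g, g′ of the cycle satisfy g + g′ = sₚ, so
-- g′ = (s₀ − g) + (sₚ − s₀); starting from g₀, every vertex therefore lies in
-- {g₀, s₀ − g₀} + ⟨s₁ − s₀, …, s_k − s₀⟩. Modulo m this set has at most 2 mᵏ elements, and the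
-- cycle visits all of G, so mʳ ≤ 2 mᵏ with k = |S| − 1. For m ≥ 2 this gives r ≤ |S|, and for
-- m ≥ 3 it gives r ≤ |S| − 1.
module Submission where

open import Defs
open import Data.Nat using (ℕ; suc; _≤_; _<_)
open import Data.List using (List; _∷_; length)
open import Data.Product using (_×_)
open import Relation.Binary.PropositionalEquality using (_≡_)

open import Algebra.Bundles using (Ring; CommutativeRing)
open import Data.Fin using (Fin; toℕ; inject₁; inject≤; opposite; combine; remQuot; finToFun; funToFin)
  renaming (zero to fz; suc to fs)
open import Function using (_∘_)

module Orbit {c ℓ} (R : Ring c ℓ) where

  open Ring R
  open import Algebra.Properties.Semiring.Sum semiring
    using (sum; ∑-distrib-+; sum-cong-≋; sum-replicate-zero; *-distribˡ-sum)
  open import Algebra.Properties.Ring R using (-1*x≈-x; -‿distribˡ-*)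
  open import Algebra.Properties.AbelianGroup +-abelianGroup using (⁻¹-∙-comm; ⁻¹-anti-homo‿-; xyx⁻¹≈y)
  open import Algebra.Properties.Group +-group using (quasigroup)
  open import Algebra.Properties.Quasigroup quasigroup using (y≈x\\z)
  open import Algebra.Properties.CommutativeSemigroup +-commutativeSemigroup using (interchange)
  open import Relation.Binary.Reasoning.Setoid setoid

  δ : ∀ {n} → Fin n → Fin n → Carrier
  δ fz     fz     = 1#
  δ fz     (fs _) = 0#
  δ (fs _) fz     = 0#
  δ (fs p) (fs q) = δ p q

  sum-0* : ∀ {n} (f : Fin n → Carrier) → sum (λ q → 0# * f q) ≈ 0#
  sum-0* {n} f = trans (sum-cong-≋ (λ q → zeroˡ (f q))) (sum-replicate-zero n)

  sum-δ* : ∀ {n} (p : Fin n) (f : Fin n → Carrier) → sum (λ q → δ p q * f q) ≈ f p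
  sum-δ* fz     f = begin
    1# * f fz + sum (λ q → 0# * f (fs q))  ≈⟨ +-cong (*-identityˡ (f fz)) (sum-0* (λ q → f (fs q))) ⟩
    f fz + 0#                              ≈⟨ +-identityʳ (f fz) ⟩
    f fz                                   ∎
  sum-δ* (fs p) f = begin
    0# * f fz + sum (λ q → δ p q * f (fs q))  ≈⟨ +-cong (zeroˡ (f fz)) (sum-δ* p (λ q → f (fs q))) ⟩
    0# + f (fs p)                             ≈⟨ +-identityˡ (f (fs p)) ⟩
    f (fs p)                                  ∎

  -‿sum : ∀ {n} (f : Fin n → Carrier) → - sum f ≈ sum (λ q → - f q)
  -‿sum f = begin
    - sum f                       ≈⟨ -1*x≈-x (sum f) ⟨
    - 1# * sum f                  ≈⟨ *-distribˡ-sum (- 1#) f ⟩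
    sum (λ q → - 1# * f q)        ≈⟨ sum-cong-≋ (λ q → -1*x≈-x (f q)) ⟩
    sum (λ q → - f q)             ∎

  reflect : ∀ {n} → Fin n → (Fin n → Carrier) → Fin n → Carrier
  reflect p c q = δ p q - c q

  module _ {k : ℕ} (x : Carrier) (s : Fin (suc k) → Carrier) where

    diff : Fin (suc k) → Carrier
    diff p = s p - s fz

    combination : (Fin (suc k) → Carrier) → Carrier
    combination c = sum (λ p → c p * diff p)

    base : Fin 2 → Carrier
    base fz     = x
    base (fs _) = s fz - x

    point : Fin 2 → (Fin (suc k) → Carrier) → Carrier
    point b c = base b + combination c

    point-start : x ≈ point fz (λ _ → 0#)
    point-start = sym (trans (+-congˡ (sum-0* diff)) (+-identityʳ x))

    s≈s₀+diff : ∀ p → s p ≈ s fz + diff p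
    s≈s₀+diff p = sym (trans (sym (+-assoc (s fz) (s p) (- s fz))) (xyx⁻¹≈y (s fz) (s p)))

    base-opposite : ∀ b → s fz - base b ≈ base (opposite b)
    base-opposite fz      = refl
    base-opposite (fs fz) = begin
      s fz - (s fz - x)       ≈⟨ +-congˡ (⁻¹-anti-homo‿- (s fz) x) ⟩
      s fz + (x - s fz)       ≈⟨ +-assoc (s fz) x (- s fz) ⟨
      s fz + x - s fz         ≈⟨ xyx⁻¹≈y (s fz) x ⟩
      x                       ∎

    combination-step : ∀ p c → combination (reflect p c) ≈ diff p - combination c
    combination-step p c = begin
      sum (λ q → (δ p q - c q) * diff q)
        ≈⟨ sum-cong-≋ (λ q → distribʳ (diff q) (δ p q) (- c q)) ⟩
      sum (λ q → δ p q * diff q + - c q * diff q)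
        ≈⟨ ∑-distrib-+ (λ q → δ p q * diff q) (λ q → - c q * diff q) ⟩
      sum (λ q → δ p q * diff q) + sum (λ q → - c q * diff q)
        ≈⟨ +-cong (sum-δ* p diff) (sum-cong-≋ (λ q → sym (-‿distribˡ-* (c q) (diff q)))) ⟩
      diff p + sum (λ q → - (c q * diff q))
        ≈⟨ +-congˡ (-‿sum (λ q → c q * diff q)) ⟨
      diff p - combination c
        ∎

    point-step : ∀ p b c {y y′} → y ≈ point b c → y + y′ ≈ s p →
                 y′ ≈ point (opposite b) (reflect p c)
    point-step p b c {y} {y′} y≈ y+y′≈ = begin
      y′                                              ≈⟨ y≈x\\z y y′ (s p) y+y′≈ ⟩
      - y + s p                                       ≈⟨ +-comm (- y) (s p) ⟩
      s p - y                                         ≈⟨ +-cong (s≈s₀+diff p) (-‿cong y≈) ⟩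
      (s fz + diff p) - (base b + combination c)      ≈⟨ +-congˡ (⁻¹-∙-comm (base b) (combination c)) ⟨
      (s fz + diff p) + (- base b - combination c)    ≈⟨ interchange (s fz) (diff p) (- base b) (- combination c) ⟩
      (s fz - base b) + (diff p - combination c)      ≈⟨ +-cong (base-opposite b) (sym (combination-step p c)) ⟩
      point (opposite b) (reflect p c)                ∎

    point-cong-tail : ∀ b {c c′} → (∀ l → c (fs l) ≈ c′ (fs l)) → point b c ≈ point b c′
    point-cong-tail b {c} {c′} c≈c′ =
      +-congˡ (+-cong (trans (c*diff₀≈0 c) (sym (c*diff₀≈0 c′))) (sum-cong-≋ (*-congʳ ∘ c≈c′)))
      where
      c*diff₀≈0 : ∀ c → c fz * diff fz ≈ 0#
      c*diff₀≈0 c = trans (*-congˡ (-‿inverseʳ (s fz))) (zeroʳ (c fz))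

open import Level using (0ℓ)
open import Data.Nat using (zero; _+_; _*_; _^_; _≤?_; pred; z≤n; s≤s; z<s; NonZero; >-nonZero)
import Data.Nat.Properties as ℕ
open import Data.Nat.DivMod using (_%_; _mod_; %-distribˡ-+; %-distribˡ-*; m*n%n≡0; m%n<n; m%n%n≡m%n; m<n⇒m%n≡m; m≤n⇒m%n≡m; m∣n⇒o%n%m≡o%m)
open import Data.Nat.Divisibility using (_∣_; ∣-refl; ∣-trans; ∣⇒≤)
open import Data.Fin.Properties using (toℕ-fromℕ<; toℕ-injective; toℕ<n; toℕ-inject₁; toℕ-inject≤; injective⇒≤; remQuot-combine; funToFin-finToFin; finToFun-funToFin)
open import Data.Fin.Induction using (<-weakInduction)
open import Data.List using ([]; lookup)
open import Data.List.Relation.Unary.All using (All; []; _∷_)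
import Data.List.Relation.Unary.All as All
open import Data.List.Relation.Unary.Any using (index)
open import Data.List.Relation.Unary.Any.Properties using (lookup-index)
open import Data.List.Relation.Unary.Linked.Properties using (Linked⇒All)
open import Data.Product using (∃-syntax; ∃₂; _,_; proj₁; proj₂)
open import Data.Unit using (tt)
open import Data.Vec.Functional using () renaming (_∷_ to _◂_)
open import Relation.Binary.PropositionalEquality using (_≗_; refl; sym; trans; cong; cong₂; subst; isEquivalence; module ≡-Reasoning)
import Relation.Binary.Construct.On as On
import Relation.Binary.Reasoning.Setoid as SetoidReasoning
open import Relation.Nullary using (yes; no; contradiction)

infix 4 _≡_[mod_]
_≡_[mod_] : ℕ → ℕ → (m : ℕ) .{{_ : NonZero m}} → Set
a ≡ b [mod m ] = a % m ≡ b % m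

module _ (m : ℕ) .{{_ : NonZero m}} where

  private
    infix 4 _≈_
    _≈_ : ℕ → ℕ → Set
    a ≈ b = a ≡ b [mod m ]

    ≡⇒≈ : ∀ {a b} → a ≡ b → a ≈ b
    ≡⇒≈ = cong (_% m)

    +-cong-mod : ∀ {a b c d} → a ≈ b → c ≈ d → a + c ≈ b + d
    +-cong-mod {a} {b} {c} {d} a≈b c≈d = begin
      (a + c) % m              ≡⟨ %-distribˡ-+ a c m ⟩
      (a % m + c % m) % m      ≡⟨ cong₂ (λ u v → (u + v) % m) a≈b c≈d ⟩
      (b % m + d % m) % m      ≡⟨ %-distribˡ-+ b d m ⟨
      (b + d) % m              ∎
      where open ≡-Reasoning

    *-cong-mod : ∀ {a b c d} → a ≈ b → c ≈ d → a * c ≈ b * d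
    *-cong-mod {a} {b} {c} {d} a≈b c≈d = begin
      (a * c) % m              ≡⟨ %-distribˡ-* a c m ⟩
      (a % m * (c % m)) % m    ≡⟨ cong₂ (λ u v → (u * v) % m) a≈b c≈d ⟩
      (b % m * (d % m)) % m    ≡⟨ %-distribˡ-* b d m ⟨
      (b * d) % m              ∎
      where open ≡-Reasoning

    neg : ℕ → ℕ
    neg a = pred m * a

    +-inverseʳ-mod : ∀ a → a + neg a ≈ 0
    +-inverseʳ-mod a = begin
      (a + pred m * a) % m     ≡⟨ cong (λ n → (n * a) % m) (ℕ.suc-pred m) ⟩
      (m * a) % m              ≡⟨ cong (_% m) (ℕ.*-comm m a) ⟩
      (a * m) % m              ≡⟨ m*n%n≡0 a m ⟩
      0                        ≡⟨ m*n%n≡0 0 m ⟨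
      0 % m                    ∎
      where open ≡-Reasoning

  -- ℤ/mℤ with natural numbers as representatives and − a := (m − 1) a.
  ℤ/_ℤ : CommutativeRing 0ℓ 0ℓ
  ℤ/_ℤ = record
    { Carrier = ℕ ; _≈_ = _≈_ ; _+_ = _+_ ; _*_ = _*_ ; -_ = neg ; 0# = 0 ; 1# = 1
    ; isCommutativeRing = record
      { isRing = record
        { +-isAbelianGroup = record
          { isGroup = record
            { isMonoid = record
              { isSemigroup = record
                { isMagma = record
                  { isEquivalence = On.isEquivalence (_% m) isEquivalence
                  ; ∙-cong = +-cong-mod }
                ; assoc = λ a b c → ≡⇒≈ (ℕ.+-assoc a b c) }
              ; identity = (λ a → refl) , (λ a → ≡⇒≈ (ℕ.+-identityʳ a)) }
            ; inverse = (λ a → trans (≡⇒≈ (ℕ.+-comm (neg a) a)) (+-inverseʳ-mod a)) , +-inverseʳ-mod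
            ; ⁻¹-cong = *-cong-mod {pred m} refl }
          ; comm = λ a b → ≡⇒≈ (ℕ.+-comm a b) }
        ; *-cong = *-cong-mod
        ; *-assoc = λ a b c → ≡⇒≈ (ℕ.*-assoc a b c)
        ; *-identity = (λ a → ≡⇒≈ (ℕ.*-identityˡ a)) , (λ a → ≡⇒≈ (ℕ.*-identityʳ a))
        ; distrib = (λ a b c → ≡⇒≈ (ℕ.*-distribˡ-+ a b c)) , (λ a b c → ≡⇒≈ (ℕ.*-distribʳ-+ a b c)) }
      ; *-comm = λ a b → ≡⇒≈ (ℕ.*-comm a b) } }

module _ {m : ℕ} .{{_ : NonZero m}} where

  toℕ-mod : ∀ a → toℕ (a mod m) ≡ a [mod m ]
  toℕ-mod a = trans (cong (_% m) (toℕ-fromℕ< (m%n<n a m))) (m%n%n≡m%n a m)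

  ≡-mod⇒mod≡ : ∀ {a} (i : Fin m) → a ≡ toℕ i [mod m ] → a mod m ≡ i
  ≡-mod⇒mod≡ {a} i a≡i = toℕ-injective (trans (toℕ-fromℕ< (m%n<n a m)) (trans a≡i (m<n⇒m%n≡m (toℕ<n i))))

coord : {ms : List ℕ} → Grp ms → Fin (length ms) → ℕ
coord {_ ∷ _} (a , _) fz     = toℕ a
coord {_ ∷ _} (_ , x) (fs j) = coord x j

coord-⊕ : ∀ {ms} m .{{_ : NonZero m}} → All (m ∣_) ms →
          ∀ (x y : Grp ms) j → coord (x ⊕ y) j ≡ coord x j + coord y j [mod m ]
coord-⊕ {suc k ∷ _} m (m∣mᵢ ∷ _) (a , _) (b , _) fz =
  trans (cong (_% m) (toℕ-fromℕ< (m%n<n (toℕ a + toℕ b) (suc k)))) (m∣n⇒o%n%m≡o%m m (suc k) _ m∣mᵢ)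
coord-⊕ {_ ∷ _} m (_ ∷ m∣ms) (_ , x) (_ , y) (fs j) = coord-⊕ m m∣ms x y j

embed : ∀ {ms m} → All (m ≤_) ms → (Fin (length ms) → Fin m) → Grp ms
embed []            v = tt
embed (m≤mᵢ ∷ m≤ms) v = inject≤ (v fz) m≤mᵢ , embed m≤ms (v ∘ fs)

coord-embed : ∀ {ms m} (m≤ms : All (m ≤_) ms) v j → coord (embed m≤ms v) j ≡ toℕ (v j)
coord-embed (m≤mᵢ ∷ _) v fz     = toℕ-inject≤ (v fz) m≤mᵢ
coord-embed (_ ∷ m≤ms) v (fs j) = coord-embed m≤ms (v ∘ fs) j

start : ∀ {ms} (S : Subset ms) → Hamiltonian ms S → Grp ms
start _ (_ , g , _) = g fz

nextIdx-inject₁ : ∀ {n} (i : Fin n) → nextIdx (inject₁ i) ≡ fs i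
nextIdx-inject₁ {n} i = toℕ-injective (begin
  toℕ (nextIdx (inject₁ i))   ≡⟨ toℕ-fromℕ< (m%n<n (suc (toℕ (inject₁ i))) (suc n)) ⟩
  suc (toℕ (inject₁ i)) % suc n ≡⟨ cong (λ t → suc t % suc n) (toℕ-inject₁ i) ⟩
  suc (toℕ i) % suc n         ≡⟨ m≤n⇒m%n≡m (toℕ<n i) ⟩
  suc (toℕ i)                 ∎)
  where open ≡-Reasoning

hamiltonian-invariant : ∀ {ms} {S : Subset ms} (P : Grp ms → Set) →
  (∀ {x y} → (x ⊕ y) ∈S S → P x → P y) → (H : Hamiltonian ms S) → P (start S H) → ∀ y → P y
hamiltonian-invariant P step (_ , g , (_ , onto) , cycle) P₀ y =
  subst P (proj₂ (onto y) refl) (along (proj₁ (onto y)))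
  where
  along : ∀ i → P (g i)
  along = <-weakInduction (P ∘ g) P₀
    (λ i → subst (P ∘ g) (nextIdx-inject₁ i) ∘ step (cycle (inject₁ i)))

funToFin-cong : ∀ {r m} {f g : Fin r → Fin m} → f ≗ g → funToFin f ≡ funToFin g
funToFin-cong {zero}  f≗g = refl
funToFin-cong {suc r} f≗g = cong₂ combine (f≗g fz) (funToFin-cong (f≗g ∘ fs))

pointwise-surjective⇒^≤ : ∀ {N r m} (F : Fin N → Fin r → Fin m) → (∀ v → ∃[ a ] F a ≗ v) → m ^ r ≤ N
pointwise-surjective⇒^≤ {r = r} {m} F onto = injective⇒≤ {f = preimage} preimage-injective
  where
  preimage : Fin (m ^ r) → Fin _
  preimage y = proj₁ (onto (finToFun y))
  preimage-injective : ∀ {y y′} → preimage y ≡ preimage y′ → y ≡ y′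
  preimage-injective {y} {y′} eq = begin
    y                               ≡⟨ funToFin-finToFin {r} {m} y ⟨
    funToFin (finToFun {m} {r} y)   ≡⟨ funToFin-cong same-image ⟩
    funToFin (finToFun {m} {r} y′)  ≡⟨ funToFin-finToFin {r} {m} y′ ⟩
    y′                              ∎
    where
    open ≡-Reasoning
    same-image : finToFun {m} {r} y ≗ finToFun y′
    same-image j = trans (sym (proj₂ (onto (finToFun y)) j))
      (trans (cong (λ a → F a j) eq) (proj₂ (onto (finToFun y′)) j))

module _ {ms : List ℕ} (m : ℕ) .{{_ : NonZero m}} (m∣ms : All (m ∣_) ms) (m≤ms : All (m ≤_) ms) where

  open CommutativeRing (ℤ/ m ℤ) using (ring; _≈_; setoid)
  open Orbit ring using (reflect; point; point-start; point-step; point-cong-tail)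

  hamiltonian⇒^≤ : ∀ s₀ ss u → Hamiltonian ms (subset (s₀ ∷ ss) u) → m ^ length ms ≤ 2 * m ^ length ss
  hamiltonian⇒^≤ s₀ ss u H = pointwise-surjective⇒^≤ (residues ∘ remQuot (m ^ length ss)) onto
    where
    S : Subset ms
    S = subset (s₀ ∷ ss) u

    x : Fin (length ms) → ℕ
    x = coord (start S H)

    s : Fin (length ms) → Fin (suc (length ss)) → ℕ
    s j p = coord (lookup (s₀ ∷ ss) p) j

    Reached : Grp ms → Set
    Reached y = ∃₂ λ b c → ∀ j → coord y j ≈ point (x j) (s j) b c

    step : ∀ {y y′} → (y ⊕ y′) ∈S S → Reached y → Reached y′
    step {y} {y′} y⊕y′∈S (b , c , y≈) =
      opposite b , reflect p c , λ j → point-step (x j) (s j) p b c (y≈ j) (sum≈ j)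
      where
      p : Fin (suc (length ss))
      p = index y⊕y′∈S
      sum≈ : ∀ j → coord y j + coord y′ j ≈ s j p
      sum≈ j = trans (sym (coord-⊕ m m∣ms y y′ j)) (cong (λ z → coord z j % m) (lookup-index y⊕y′∈S))

    reached : ∀ y → Reached y
    reached = hamiltonian-invariant {S = S} Reached step H (fz , (λ _ → 0) , λ j → point-start (x j) (s j))

    residues : Fin 2 × Fin (m ^ length ss) → Fin (length ms) → Fin m
    residues (b , code) j = point (x j) (s j) b (0 ◂ toℕ ∘ finToFun code) mod m

    onto : ∀ v → ∃[ a ] residues (remQuot (m ^ length ss) a) ≗ v
    onto v with reached (embed m≤ms v)
    ... | b , c , v≈ = combine b code , λ j →
      trans (cong (λ bc → residues bc j) (remQuot-combine b code)) (≡-mod⇒mod≡ (v j) (v≈point j))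
      where
      code : Fin (m ^ length ss)
      code = funToFin (λ l → c (fs l) mod m)
      v≈point : ∀ j → point (x j) (s j) b (0 ◂ toℕ ∘ finToFun code) ≈ toℕ (v j)
      v≈point j = begin
        point (x j) (s j) b (0 ◂ toℕ ∘ finToFun code)
          ≈⟨ point-cong-tail (x j) (s j) b {c = 0 ◂ toℕ ∘ finToFun code} {c′ = c} (λ l →
               trans (cong (λ i → toℕ i % m) (finToFun-funToFin _ l)) (toℕ-mod (c (fs l)))) ⟩
        point (x j) (s j) b c      ≈⟨ v≈ j ⟨
        coord (embed m≤ms v) j     ≡⟨ coord-embed m≤ms v j ⟩
        toℕ (v j)                  ∎
        where open SetoidReasoning setoid

^≤*^⇒≤ : ∀ {m n a b} → n < m → m ^ a ≤ n * m ^ b → a ≤ b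
^≤*^⇒≤ {m} {n} {a} {b} n<m m^a≤n*m^b with a ≤? b
... | yes a≤b = a≤b
... | no  a≰b = contradiction m^a≤n*m^b (ℕ.<⇒≱ (begin-strict
  n * m ^ b    <⟨ ℕ.*-monoˡ-< (m ^ b) {{ℕ.m^n≢0 m b}} n<m ⟩
  m ^ suc b    ≤⟨ ℕ.^-monoʳ-≤ m (ℕ.≰⇒> a≰b) ⟩
  m ^ a        ∎))
  where
  open ℕ.≤-Reasoning
  instance
    m≢0 : NonZero m
    m≢0 = >-nonZero (ℕ.≤-<-trans z≤n n<m)

corollary1 : (ms : List ℕ) → IsType ms → (S : Subset ms) → Hamiltonian ms S →
    (length ms ≤ ∣ S ∣)
    × ((m : ℕ) (ms′ : List ℕ) → ms ≡ m ∷ ms′ → 2 < m → suc (length ms) ≤ ∣ S ∣)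
corollary1 []        _ S H = z≤n , λ _ _ ()
corollary1 (m ∷ ms′) _ (subset [] _) (_ , _ , _ , cycle) with cycle fz
... | ()
corollary1 ms@(m ∷ ms′) (1<m ∷ 1<ms′ , linked) (subset (s₀ ∷ ss) u) H =
  ^≤*^⇒≤ 1<m bound′ ,
  λ { _ _ refl 2<m → s≤s (^≤*^⇒≤ 2<m bound) }
  where
  instance
    m≢0 : NonZero m
    m≢0 = >-nonZero (ℕ.<-trans z<s 1<m)
  m∣ms : All (m ∣_) ms
  m∣ms = Linked⇒All ∣-trans ∣-refl linked
  m≤ms : All (m ≤_) ms
  m≤ms = All.zipWith (λ (1<mᵢ , m∣mᵢ) → ∣⇒≤ {{>-nonZero (ℕ.<-trans z<s 1<mᵢ)}} m∣mᵢ) (1<m ∷ 1<ms′ , m∣ms)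
  bound : m ^ length ms ≤ 2 * m ^ length ss
  bound = hamiltonian⇒^≤ m m∣ms m≤ms s₀ ss u H
  bound′ : m ^ length ms ≤ 1 * m ^ suc (length ss)
  bound′ = begin
    m ^ length ms           ≤⟨ bound ⟩
    2 * m ^ length ss       ≤⟨ ℕ.*-monoˡ-≤ (m ^ length ss) 1<m ⟩
    m ^ suc (length ss)     ≡⟨ ℕ.*-identityˡ _ ⟨
    1 * m ^ suc (length ss) ∎
    where open ℕ.≤-Reasoning
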